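{- The gluing fibration $\pi:\mathcal G\to\mathrm{DF}(\mathcal C)$ reflects representable maps: if $p:Y\to X$ is a map of $\mathcal G$ such that $\pi(p)$ is a representable map of $\mathrm{DF}(\mathcal C)$, then $p$ is a compact map of $\mathcal G$.
   Context: $\square$ is the category of Cartesian cubes (free finite-product category on a bi-pointed object), $\mathrm{cSET}$ is presheaves on $\square$. Let $\mathcal C$ be the category of contexts of a model of XTT, with its interval giving a finite-product preserving $\mathcal I:\square\to\mathcal C$. $\mathrm{DF}(\mathcal C)$ denotes discrete fibrations over $\mathcal C$ (equivalent to presheaves), with Yoneda embedding $y_{\mathcal C}$; $F:\mathrm{DF}(\mathcal C)\to\mathrm{cSET}$ is restriction along $\mathcal I$ and $N_{\mathcal I}=F\circ y_{\mathcal C}$. $\mathcal G=\mathrm{cSET}\downarrow F$ (objects $(E,X,e:E\to F X)$) with projection $\pi(E,X,e)=X$; $\mathcal G_c=\mathrm{cSET}\downarrow N_{\mathcal I}$, with fully faithful $i:\mathcal G_c\to\mathcal G$, $(E,\Gamma,e)\mapsto(E,y_{\mathcal C}\Gamma,e)$. An object of $\mathcal G$ is compact if it is in the essential image of $i$ (equivalently its image under $\pi$ is representable). A map $p:Y\to X$ of $\mathcal G$ is compact if for every map $x:i(\Gamma)\to X$ the pullback $Y\times_X i(\Gamma)$ is compact. A map $f:Y\to X$ of $\mathrm{DF}(\mathcal C)$ is representable if for every $x:y_{\mathcal C}(C)\to X$ the pullback $Y\times_X y_{\mathcal C}(C)$ is representable. -}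

module Defs where

open import Level using (Level; _⊔_) renaming (suc to lsuc; zero to lzero)
open import Data.Nat using (ℕ; zero; suc; _+_)
open import Data.Fin using (Fin; _↑ˡ_; _↑ʳ_)
open import Data.Bool using (Bool)
open import Data.Sum using (_⊎_; inj₁; inj₂)
open import Data.Product using (Σ; Σ-syntax; _×_; _,_)
open import Data.Vec using (Vec; tabulate; lookup; map)
open import Relation.Binary.PropositionalEquality
  using (_≡_; refl; sym; trans; cong)

record Cat (o h e : Level) : Set (lsuc (o ⊔ h ⊔ e)) where
  infixr 9 _∘_
  infix 4 _≈_
  field
    Obj : Set o
    Hom : Obj → Obj → Set h
    _≈_ : ∀ {A B} → Hom A B → Hom A B → Set e
    id  : ∀ {A} → Hom A A
    _∘_ : ∀ {A B D} → Hom B D → Hom A B → Hom A D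
    ≈-refl  : ∀ {A B} {f : Hom A B} → f ≈ f
    ≈-sym   : ∀ {A B} {f g : Hom A B} → f ≈ g → g ≈ f
    ≈-trans : ∀ {A B} {f g k : Hom A B} → f ≈ g → g ≈ k → f ≈ k
    ∘-resp-≈ : ∀ {A B D} {f f' : Hom B D} {g g' : Hom A B} →
               f ≈ f' → g ≈ g' → f ∘ g ≈ f' ∘ g'
    assoc     : ∀ {A B D E} {f : Hom D E} {g : Hom B D} {k : Hom A B} →
                (f ∘ g) ∘ k ≈ f ∘ (g ∘ k)
    identityˡ : ∀ {A B} {f : Hom A B} → id ∘ f ≈ f
    identityʳ : ∀ {A B} {f : Hom A B} → f ∘ id ≈ f

module _ {o h e} (𝒟 : Cat o h e) where
  open Cat 𝒟

  Iso : Obj → Obj → Set (h ⊔ e)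
  Iso A B = Σ[ f ∈ Hom A B ] Σ[ g ∈ Hom B A ] ((g ∘ f ≈ id) × (f ∘ g ≈ id))

  IsPullback : ∀ {A B D P} (f : Hom A D) (g : Hom B D)
               (p₁ : Hom P A) (p₂ : Hom P B) → Set (o ⊔ h ⊔ e)
  IsPullback {A} {B} {D} {P} f g p₁ p₂ =
    (f ∘ p₁ ≈ g ∘ p₂) ×
    (∀ (Q : Obj) (q₁ : Hom Q A) (q₂ : Hom Q B) → f ∘ q₁ ≈ g ∘ q₂ →
       Σ[ u ∈ Hom Q P ] ((p₁ ∘ u ≈ q₁) × (p₂ ∘ u ≈ q₂) ×
         (∀ (u' : Hom Q P) → p₁ ∘ u' ≈ q₁ → p₂ ∘ u' ≈ q₂ → u' ≈ u)))

-- A (small, locally small) category with strict hom-equality: the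
-- category of contexts C.

record SmallCat : Set₁ where
  infixr 9 _∘_
  field
    Obj : Set
    Hom : Obj → Obj → Set
    id  : ∀ {A} → Hom A A
    _∘_ : ∀ {A B D} → Hom B D → Hom A B → Hom A D
    assoc     : ∀ {A B D E} {f : Hom D E} {g : Hom B D} {k : Hom A B} →
                (f ∘ g) ∘ k ≡ f ∘ (g ∘ k)
    identityˡ : ∀ {A B} {f : Hom A B} → id ∘ f ≡ f
    identityʳ : ∀ {A B} {f : Hom A B} → f ∘ id ≡ f

-- The Cartesian cube category □ (free finite-product category on a
-- bi-pointed object).  Objects: n : ℕ (standing for 𝕀ⁿ).  A map n → m is
-- an m-tuple each of whose entries is a variable among n or an endpoint.

Cube : ℕ → ℕ → Set
Cube n m = Vec (Fin n ⊎ Bool) m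

idC : ∀ n → Cube n n
idC n = tabulate inj₁

-- compC g f = g ∘ f  (f : n → m, g : m → k)
compC : ∀ {n m k} → Cube m k → Cube n m → Cube n k
compC g f = map (λ { (inj₁ j) → lookup f j ; (inj₂ b) → inj₂ b }) g

π₁C : ∀ n m → Cube (n + m) n
π₁C n m = tabulate (λ j → inj₁ (j ↑ˡ m))

π₂C : ∀ n m → Cube (n + m) m
π₂C n m = tabulate (λ j → inj₁ (n ↑ʳ j))

record CSet : Set₁ where
  field
    ob     : ℕ → Set
    act    : ∀ {n m} → Cube n m → ob m → ob n
    act-id : ∀ {n} (x : ob n) → act (idC n) x ≡ x
    act-comp : ∀ {n m k} (g : Cube m k) (f : Cube n m) (x : ob k) →
               act (compC g f) x ≡ act f (act g x)

record CHom (E E' : CSet) : Set where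
  private
    module E  = CSet E
    module E' = CSet E'
  field
    comp : ∀ n → E.ob n → E'.ob n
    nat  : ∀ {n m} (f : Cube n m) (x : E.ob m) →
           comp n (E.act f x) ≡ E'.act f (comp m x)

module OverC (C : SmallCat) where
  open SmallCat C

  -- presheaves on C  (= discrete fibrations DF(C), up to equivalence)
  record Psh : Set₁ where
    field
      ob     : Obj → Set
      act    : ∀ {A B} → Hom A B → ob B → ob A
      act-id : ∀ {A} (x : ob A) → act id x ≡ x
      act-comp : ∀ {A B D} (g : Hom B D) (f : Hom A B) (x : ob D) →
                 act (g ∘ f) x ≡ act f (act g x)

  record PHom (X X' : Psh) : Set where
    private
      module X  = Psh X
      module X' = Psh X'
    field
      comp : ∀ A → X.ob A → X'.ob A
      nat  : ∀ {A B} (f : Hom A B) (x : X.ob B) →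
             comp A (X.act f x) ≡ X'.act f (comp B x)

  PshCat : Cat (lsuc lzero) lzero lzero
  PshCat = record
    { Obj = Psh
    ; Hom = PHom
    ; _≈_ = λ α β → ∀ A x → PHom.comp α A x ≡ PHom.comp β A x
    ; id  = record { comp = λ _ x → x ; nat = λ _ _ → refl }
    ; _∘_ = λ α β → record
        { comp = λ A x → PHom.comp α A (PHom.comp β A x)
        ; nat  = λ f x → trans (cong (PHom.comp α _) (PHom.nat β f x))
                               (PHom.nat α f (PHom.comp β _ x)) }
    ; ≈-refl  = λ _ _ → refl
    ; ≈-sym   = λ p A x → sym (p A x)
    ; ≈-trans = λ p q A x → trans (p A x) (q A x)
    ; ∘-resp-≈ = λ {_} {_} {_} {f} {f'} {g} {g'} p q A x →
        trans (cong (PHom.comp f A) (q A x)) (p A (PHom.comp g' A x))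
    ; assoc     = λ _ _ → refl
    ; identityˡ = λ _ _ → refl
    ; identityʳ = λ _ _ → refl
    }

  y : Obj → Psh
  y Γ = record
    { ob = λ Δ → Hom Δ Γ
    ; act = λ f g → g ∘ f
    ; act-id = λ g → identityʳ
    ; act-comp = λ g f k → sym assoc }

  Representable : Psh → Set
  Representable P = Σ[ D ∈ Obj ] Iso PshCat P (y D)

  RepresentableMap : ∀ {Y X} → PHom Y X → Set₁
  RepresentableMap {Y} {X} f =
    ∀ (D : Obj) (x : PHom (y D) X) (P : Psh)
      (p₁ : PHom P Y) (p₂ : PHom P (y D)) →
    IsPullback PshCat f x p₁ p₂ → Representable P

  record Interval : Set where
    field
      obj  : ℕ → Obj
      hom  : ∀ {n m} → Cube n m → Hom (obj n) (obj m)
      hom-id   : ∀ n → hom (idC n) ≡ id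
      hom-comp : ∀ {n m k} (g : Cube m k) (f : Cube n m) →
                 hom (compC g f) ≡ hom g ∘ hom f

  IsTerminal : Obj → Set
  IsTerminal T = ∀ A → Σ[ u ∈ Hom A T ] (∀ (v : Hom A T) → v ≡ u)

  IsProduct : ∀ {P A B} → Hom P A → Hom P B → Set
  IsProduct {P} {A} {B} p₁ p₂ =
    ∀ Q (q₁ : Hom Q A) (q₂ : Hom Q B) →
    Σ[ u ∈ Hom Q P ] ((p₁ ∘ u ≡ q₁) × (p₂ ∘ u ≡ q₂) ×
      (∀ (v : Hom Q P) → p₁ ∘ v ≡ q₁ → p₂ ∘ v ≡ q₂ → v ≡ u))

  PreservesFiniteProducts : Interval → Set
  PreservesFiniteProducts I =
    IsTerminal (obj 0) ×
    (∀ n m → IsProduct (hom (π₁C n m)) (hom (π₂C n m)))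
    where open Interval I

  module Glue (I : Interval) where
    open Interval I

    F : Psh → CSet
    F X = record
      { ob = λ n → X.ob (obj n)
      ; act = λ f x → X.act (hom f) x
      ; act-id = λ {n} x → trans (cong (λ h → X.act h x) (hom-id n)) (X.act-id x)
      ; act-comp = λ g f x → trans (cong (λ h → X.act h x) (hom-comp g f))
                                   (X.act-comp (hom g) (hom f) x) }
      where module X = Psh X

    F₁ : ∀ {X X'} → PHom X X' → CHom (F X) (F X')
    F₁ α = record { comp = λ n → PHom.comp α (obj n)
                  ; nat = λ f x → PHom.nat α (hom f) x }

    N : Obj → CSet
    N Γ = F (y Γ)

    record GObj : Set₁ where
      constructor gobj
      field
        E : CSet
        X : Psh
        e : CHom E (F X)

    record GHom (P Q : GObj) : Set where
      private
        module P = GObj P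
        module Q = GObj Q
      field
        a : CHom P.E Q.E
        b : PHom P.X Q.X
        comm : ∀ n (x : CSet.ob P.E n) →
               CHom.comp Q.e n (CHom.comp a n x) ≡
               CHom.comp (F₁ b) n (CHom.comp P.e n x)

    GCat : Cat (lsuc lzero) lzero lzero
    GCat = record
      { Obj = GObj
      ; Hom = GHom
      ; _≈_ = λ f g → (∀ n x → CHom.comp (GHom.a f) n x ≡ CHom.comp (GHom.a g) n x) ×
                      (∀ A x → PHom.comp (GHom.b f) A x ≡ PHom.comp (GHom.b g) A x)
      ; id = record
          { a = record { comp = λ _ x → x ; nat = λ _ _ → refl }
          ; b = record { comp = λ _ x → x ; nat = λ _ _ → refl }
          ; comm = λ _ _ → refl }
      ; _∘_ = λ f g → record
          { a = record
              { comp = λ n x → CHom.comp (GHom.a f) n (CHom.comp (GHom.a g) n x)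
              ; nat = λ h x → trans (cong (CHom.comp (GHom.a f) _) (CHom.nat (GHom.a g) h x))
                                    (CHom.nat (GHom.a f) h (CHom.comp (GHom.a g) _ x)) }
          ; b = record
              { comp = λ A x → PHom.comp (GHom.b f) A (PHom.comp (GHom.b g) A x)
              ; nat = λ h x → trans (cong (PHom.comp (GHom.b f) _) (PHom.nat (GHom.b g) h x))
                                    (PHom.nat (GHom.b f) h (PHom.comp (GHom.b g) _ x)) }
          ; comm = λ n x → trans (GHom.comm f n (CHom.comp (GHom.a g) n x))
                                 (cong (PHom.comp (GHom.b f) (obj n)) (GHom.comm g n x)) }
      ; ≈-refl = (λ _ _ → refl) , (λ _ _ → refl)
      ; ≈-sym = λ { (p , q) → (λ n x → sym (p n x)) , (λ A x → sym (q A x)) }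
      ; ≈-trans = λ { (p , q) (p' , q') → (λ n x → trans (p n x) (p' n x)) ,
                                          (λ A x → trans (q A x) (q' A x)) }
      ; ∘-resp-≈ = λ {_} {_} {_} {f} {f'} {g} {g'} → λ { (p , q) (p' , q') →
          (λ n x → trans (cong (CHom.comp (GHom.a f) n) (p' n x))
                         (p n (CHom.comp (GHom.a g') n x))) ,
          (λ A x → trans (cong (PHom.comp (GHom.b f) A) (q' A x))
                         (q A (PHom.comp (GHom.b g') A x))) }
      ; assoc = (λ _ _ → refl) , (λ _ _ → refl)
      ; identityˡ = (λ _ _ → refl) , (λ _ _ → refl)
      ; identityʳ = (λ _ _ → refl) , (λ _ _ → refl)
      }

    π₀ : GObj → Psh
    π₀ = GObj.X

    π₁ : ∀ {P Q} → GHom P Q → PHom (π₀ P) (π₀ Q)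
    π₁ = GHom.b

    record GcObj : Set₁ where
      constructor gcobj
      field
        E : CSet
        Γ : Obj
        e : CHom E (N Γ)

    i : GcObj → GObj
    i c = gobj (GcObj.E c) (y (GcObj.Γ c)) (GcObj.e c)

    IsCompact : GObj → Set₁
    IsCompact Z = Σ[ c ∈ GcObj ] Iso GCat Z (i c)

    CompactMap : ∀ {Y X} → GHom Y X → Set₁
    CompactMap {Y} {X} p =
      ∀ (c : GcObj) (x : GHom (i c) X) (P : GObj)
        (p₁ : GHom P Y) (p₂ : GHom P (i c)) →
      IsPullback GCat p x p₁ p₂ → IsCompact P

module Submission where

-- The argument rests on two general facts about the gluing category
-- G = cSET ↓ F, both independent of the interval preserving products.
--
--  1. π preserves pullbacks.  π has a left adjoint `free`, sending a
--     presheaf Q to the glued object (∅, Q, !) over the empty cubical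
--     set; maps free Q → Z are exactly maps Q → π Z.  Testing the
--     universal property of a G-pullback against objects `free Q`
--     therefore yields the universal property of its image in DF(C).
--
--  2. An object of G is compact as soon as its base is representable.
--     Any iso X ≅ X' of bases lifts to an iso (E, X, e) ≅ (E, X', F(f)∘e)
--     in G whose cubical component is the identity (`rebase`).
--
-- Given a pullback of p along x : i(c) → X in G, fact 1 makes its image
-- a pullback of π(p) along the representable y(Γ), so representability of
-- π(p) makes the base of the pullback representable, and fact 2 finishes.

open import Defs
open import Data.Empty using (⊥)
open import Data.Product using (_,_; proj₁; proj₂)
open import Relation.Binary.PropositionalEquality using (refl; sym; trans; cong)

module Gluing (C : SmallCat) (I : OverC.Interval C) where
  open OverC C
  open Glue I
  open Interval I using (obj; hom)

  emptyCSet : CSet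
  emptyCSet = record
    { ob = λ _ → ⊥ ; act = λ _ () ; act-id = λ () ; act-comp = λ _ _ () }

  fromEmpty : (E : CSet) → CHom emptyCSet E
  fromEmpty E = record { comp = λ _ () ; nat = λ _ () }

  -- The left adjoint of π: glue a presheaf along the empty cubical set.
  free : Psh → GObj
  free Q = gobj emptyCSet Q (fromEmpty (F Q))

  transpose : ∀ {Q} {Z : GObj} → PHom Q (π₀ Z) → GHom (free Q) Z
  transpose {Z = Z} f = record
    { a = fromEmpty (GObj.E Z) ; b = f ; comm = λ _ () }

  -- A cone over the image, with apex Q,
  -- transposes to a cone in G with apex `free Q`; the mediating map and its
  -- uniqueness descend along π.  Equality in G is componentwise; for maps
  -- out of `free Q` the cubical component is vacuous (empty domain), so it
  -- amounts to equality of the images under π.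
  π-preserves-pullbacks :
    ∀ {A B D P} {f : GHom A D} {g : GHom B D} {p₁ : GHom P A} {p₂ : GHom P B} →
    IsPullback GCat f g p₁ p₂ →
    IsPullback PshCat (π₁ f) (π₁ g) (π₁ p₁) (π₁ p₂)
  π-preserves-pullbacks (square , universal) =
    proj₂ square ,
    λ Q q₁ q₂ commutes →
      let (u , u₁ , u₂ , unique) =
            universal (free Q) (transpose q₁) (transpose q₂) ((λ _ ()) , commutes)
      in π₁ u , proj₂ u₁ , proj₂ u₂ ,
         λ u' e₁ e₂ → proj₂ (unique (transpose u') ((λ _ ()) , e₁) ((λ _ ()) , e₂))

  _⊙_ : ∀ {E X X'} → PHom X X' → CHom E (F X) → CHom E (F X')
  f ⊙ e = record
    { comp = λ n z → PHom.comp f (obj n) (CHom.comp e n z)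
    ; nat = λ h z → trans (cong (PHom.comp f _) (CHom.nat e h z))
                          (PHom.nat f (hom h) (CHom.comp e _ z)) }

  rebase : (Z : GObj) {X' : Psh} (iso : Iso PshCat (π₀ Z) X') →
           Iso GCat Z (gobj (GObj.E Z) X' (proj₁ iso ⊙ GObj.e Z))
  rebase Z (f , g , g∘f≈id , f∘g≈id) =
    forward , backward , ((λ _ _ → refl) , g∘f≈id) , ((λ _ _ → refl) , f∘g≈id)
    where
      open GObj Z
      idE : CHom E E
      idE = record { comp = λ _ z → z ; nat = λ _ _ → refl }

      forward : GHom Z (gobj E _ (f ⊙ e))
      forward = record { a = idE ; b = f ; comm = λ _ _ → refl }

      backward : GHom (gobj E _ (f ⊙ e)) Z
      backward = record
        { a = idE ; b = g
        ; comm = λ n z → sym (g∘f≈id (obj n) (CHom.comp e n z)) }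

  compact-of-representable-base : (Z : GObj) → Representable (π₀ Z) → IsCompact Z
  compact-of-representable-base Z (Γ , iso) =
    gcobj (GObj.E Z) Γ (proj₁ iso ⊙ GObj.e Z) , rebase Z iso

-- The interval preserving finite products is part of the setting but not
-- needed: the argument works for any functor □ → C.
lemma5p10 : (C : SmallCat) (I : OverC.Interval C) →
    OverC.PreservesFiniteProducts C I →
    ∀ {Y X : OverC.Glue.GObj C I} (p : OverC.Glue.GHom C I Y X) →
    OverC.RepresentableMap C (OverC.Glue.π₁ C I p) →
    OverC.Glue.CompactMap C I p
lemma5p10 C I _ p π-p-representable c x P p₁ p₂ pullback =
  compact-of-representable-base P
    (π-p-representable Γ (π₁ x) (π₀ P) (π₁ p₁) (π₁ p₂)
      (π-preserves-pullbacks {f = p} {g = x} {p₁ = p₁} {p₂ = p₂} pullback))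
  where
    open OverC.Glue C I using (π₀; π₁; GcObj)
    open Gluing C I
    open GcObj c using (Γ)
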